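{- Let $d\ge1$, $k\ge1$, let $\Gamma$ be a subtree of $T_k$, and let $D_\Gamma$ be the $\mathcal D$-class of $\mathrm{PAut}_c(T_k)$ consisting of all $\sigma$ with $\mathrm{dom}(\sigma)\cong\Gamma$. Then every $\mathcal H$-class contained in $D_\Gamma$ has cardinality $|\mathrm{Aut}\,\Gamma|$.
   Context: $T_k$ is the rooted $k$-level $d$-regular tree (root at level 0, every vertex at level $<k$ has exactly $d$ children). A subtree means a connected subgraph containing the root. $\mathrm{PAut}_c(T_k)$ is the semigroup of injective partial maps $\varphi$ of the vertex set of $T_k$ that are graph isomorphisms between the subgraphs induced on domain and range, whose domain induces a connected subgraph containing the root, and which preserve vertex levels; composition is $(\varphi\psi)(x)=\psi(\varphi(x))$. $\mathrm{dom}(\sigma)\cong\Gamma$ means isomorphism as rooted trees. $\mathrm{Aut}\,\Gamma$ is the automorphism group of $\Gamma$ as a rooted tree. $\mathcal H,\mathcal D$ are Green's relations. -}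

module Defs where

open import Data.Nat using (ℕ; _≤_)
open import Data.Fin using (Fin)
open import Data.List using (List; []; _∷_; length)
open import Data.Maybe using (Maybe; just; nothing; _>>=_)
open import Data.Product using (Σ; _×_; _,_; proj₁; proj₂)
open import Data.Sum using (_⊎_)
open import Relation.Binary.PropositionalEquality using (_≡_; refl; sym; trans)
open import Relation.Binary.Bundles using (Setoid)

-- A vertex is an address: a list of child indices, stored in REVERSED
-- order (head = last step).  The root is [], the children of x are
-- i ∷ x (i : Fin d), the level of x is its length.

Addr : ℕ → Set
Addr d = List (Fin d)

level : {d : ℕ} → Addr d → ℕ
level = length

InT : {d : ℕ} → ℕ → Addr d → Set
InT k x = level x ≤ k

Adj : {d : ℕ} → Addr d → Addr d → Set
Adj {d} x y = (Σ (Fin d) λ i → y ≡ i ∷ x) ⊎ (Σ (Fin d) λ i → x ≡ i ∷ y)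

VSet : ℕ → Set₁
VSet d = Addr d → Set

-- Γ is a subtree of T_k: a set of vertices of T_k inducing a connected
-- subgraph containing the root, i.e. containing the root and closed
-- under taking parents.
IsSubtree : {d : ℕ} → ℕ → VSet d → Set
IsSubtree {d} k Γ =
  (∀ x → Γ x → InT k x) × Γ [] × (∀ (i : Fin d) x → Γ (i ∷ x) → Γ x)

PMap : ℕ → Set
PMap d = Addr d → Maybe (Addr d)

dom : {d : ℕ} → PMap d → VSet d
dom {d} φ x = Σ (Addr d) λ y → φ x ≡ just y

ran : {d : ℕ} → PMap d → VSet d
ran {d} φ y = Σ (Addr d) λ x → φ x ≡ just y

_≈_ : {d : ℕ} → PMap d → PMap d → Set
φ ≈ ψ = ∀ x → φ x ≡ ψ x

-- composition, written left to right: (φ ∙ ψ)(x) = ψ(φ(x))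
_∙_ : {d : ℕ} → PMap d → PMap d → PMap d
(φ ∙ ψ) x = φ x >>= ψ

IsPartialIso : {d : ℕ} → PMap d → Set
IsPartialIso {d} φ =
  (∀ x x' (z : Addr d) → φ x ≡ just z → φ x' ≡ just z → x ≡ x')
  × (∀ x y x' y' → φ x ≡ just x' → φ y ≡ just y' →
       (Adj x y → Adj x' y') × (Adj x' y' → Adj x y))

IsPAut : {d : ℕ} → ℕ → PMap d → Set
IsPAut {d} k φ =
  IsSubtree k (dom φ)
  × IsPartialIso φ
  × (∀ x (y : Addr d) → φ x ≡ just y → level y ≡ level x)

-- Green's relations in S = PAut_c(T_k)  (with S¹ = S ∪ {1})

InRightIdeal : {d : ℕ} → ℕ → PMap d → PMap d → Set
InRightIdeal {d} k σ τ = σ ≈ τ ⊎ (Σ (PMap d) λ a → IsPAut k a × σ ≈ (τ ∙ a))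

InLeftIdeal : {d : ℕ} → ℕ → PMap d → PMap d → Set
InLeftIdeal {d} k σ τ = σ ≈ τ ⊎ (Σ (PMap d) λ a → IsPAut k a × σ ≈ (a ∙ τ))

GreenR : {d : ℕ} → ℕ → PMap d → PMap d → Set
GreenR k σ τ = InRightIdeal k σ τ × InRightIdeal k τ σ

GreenL : {d : ℕ} → ℕ → PMap d → PMap d → Set
GreenL k σ τ = InLeftIdeal k σ τ × InLeftIdeal k τ σ

GreenH : {d : ℕ} → ℕ → PMap d → PMap d → Set
GreenH k σ τ = GreenR k σ τ × GreenL k σ τ

IsRootedIso : {d : ℕ} → VSet d → VSet d → PMap d → Set
IsRootedIso {d} A B f =
  (∀ x → (dom f x → A x) × (A x → dom f x))
  × (∀ y → (ran f y → B y) × (B y → ran f y))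
  × IsPartialIso f
  × f [] ≡ just []

_≅_ : {d : ℕ} → VSet d → VSet d → Set
_≅_ {d} A B = Σ (PMap d) λ f → IsRootedIso A B f

IsAut : {d : ℕ} → VSet d → PMap d → Set
IsAut Γ f = IsRootedIso Γ Γ f

subSetoid : (d : ℕ) → (PMap d → Set) → Setoid _ _
subSetoid d P = record
  { Carrier = Σ (PMap d) P
  ; _≈_ = λ a b → proj₁ a ≈ proj₁ b
  ; isEquivalence = record
    { refl = λ _ → refl
    ; sym = λ p x → sym (p x)
    ; trans = λ p q x → trans (p x) (q x)
    }
  }

HClass : {d : ℕ} → ℕ → PMap d → Setoid _ _
HClass {d} k σ = subSetoid d (λ τ → IsPAut k τ × GreenH k τ σ)

AutSetoid : {d : ℕ} → VSet d → Setoid _ _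
AutSetoid {d} Γ = subSetoid d (IsAut Γ)

{-# OPTIONS --safe #-}
-- The H-class of σ consists exactly of the rooted isomorphisms from dom σ
-- onto ran σ: an element τ of PAut_c(T_k) with the same domain and range
-- as σ factors as τ = σ(σ⁻¹τ) = (τσ⁻¹)σ.  Given a rooted isomorphism f : dom σ ≅ Γ,
-- the map τ ↦ f⁻¹ τ σ⁻¹ f carries these onto Aut Γ, with inverse
-- h ↦ f h f⁻¹ σ.  Inverses of partial maps exist as maps because a rooted
-- isomorphism of a subtree preserves levels, so preimages can be found by
-- searching the finitely many vertices of one level.
module Submission where

open import Defs
open import Data.Nat using (ℕ; zero; suc; _≤_)
open import Data.Nat.Properties using (m≢1+n+m)
open import Data.Fin using (Fin)
open import Data.Fin.Properties using () renaming (_≟_ to _≟ᶠ_)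
open import Data.List using (List; []; _∷_; [_]; allFin; cartesianProductWith)
open import Data.List.Properties using (∷-injectiveʳ) renaming (≡-dec to ≡-decᴸ)
open import Data.List.Membership.Propositional using (_∈_; lose)
open import Data.List.Membership.Propositional.Properties
  using (∈-allFin; ∈-cartesianProductWith⁺)
open import Data.List.Relation.Unary.Any using (Any; here; any?; satisfied)
open import Data.Maybe using (Maybe; just; nothing)
open import Data.Maybe.Properties using (just-injective) renaming (≡-dec to ≡-decᴹ)
open import Data.Product using (Σ; ∃-syntax; _×_; _,_; proj₁; proj₂)
open import Data.Sum using (inj₁; inj₂)
open import Data.Empty using (⊥-elim)
open import Relation.Nullary using (Dec; yes; no)
open import Relation.Unary using (_⊆_; _≐_)
open import Relation.Unary.Properties using (≐-refl; ≐-sym; ≐-trans)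
open import Relation.Binary.Bundles using (Setoid)
open import Relation.Binary.PropositionalEquality
  using (_≡_; refl; sym; trans; cong; subst; _→-setoid_)
open import Function.Base using (id; _∘_)
open import Function.Bundles using (Inverse)
open import Function.Construct.Composition using (inverse)
import Relation.Binary.Reasoning.Setoid as SetoidReasoning

module _ {d : ℕ} where

  private
    variable
      A B C A′ B′ : VSet d
      k : ℕ

  _⊑_ : PMap d → PMap d → Set
  φ ⊑ ψ = ∀ {x z} → φ x ≡ just z → ψ x ≡ just z

  ⊑-antisym : ∀ {φ ψ : PMap d} → φ ⊑ ψ → ψ ⊑ φ → φ ≈ ψ
  ⊑-antisym {φ} {ψ} φ⊑ψ ψ⊑φ x with φ x in φx
  ... | just z  = sym (φ⊑ψ φx)
  ... | nothing with ψ x in ψx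
  ...   | nothing = refl
  ...   | just z  = trans (sym φx) (ψ⊑φ ψx)

  ∙-just⁺ : ∀ (φ ψ : PMap d) {x y z} → φ x ≡ just y → ψ y ≡ just z → (φ ∙ ψ) x ≡ just z
  ∙-just⁺ φ ψ φx≡y ψy≡z rewrite φx≡y = ψy≡z

  ∙-just⁻ : ∀ (φ ψ : PMap d) {x z} → (φ ∙ ψ) x ≡ just z →
            ∃[ y ] φ x ≡ just y × ψ y ≡ just z
  ∙-just⁻ φ ψ {x} e with φ x
  ... | just y = y , refl , e

  ∙-assoc : ∀ (φ ψ χ : PMap d) → ((φ ∙ ψ) ∙ χ) ≈ (φ ∙ (ψ ∙ χ))
  ∙-assoc φ ψ χ x with φ x
  ... | just _  = refl
  ... | nothing = refl

  ∙-cong : ∀ {φ φ′ ψ ψ′ : PMap d} → φ ≈ φ′ → ψ ≈ ψ′ → (φ ∙ ψ) ≈ (φ′ ∙ ψ′)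
  ∙-cong {φ′ = φ′} φ≈φ′ ψ≈ψ′ x rewrite φ≈φ′ x with φ′ x
  ... | just y  = ψ≈ψ′ y
  ... | nothing = refl

  PMap-setoid : Setoid _ _
  PMap-setoid = Addr d →-setoid Maybe (Addr d)

  open Setoid PMap-setoid using () renaming (refl to ≈-refl; sym to ≈-sym; trans to ≈-trans)

  ∙-reassoc : ∀ (α β γ δ ε : PMap d) →
              ((α ∙ ((β ∙ γ) ∙ δ)) ∙ ε) ≈ (((α ∙ β) ∙ γ) ∙ (δ ∙ ε))
  ∙-reassoc α β γ δ ε = begin
    (α ∙ ((β ∙ γ) ∙ δ)) ∙ ε  ≈⟨ ∙-assoc α _ ε ⟩
    α ∙ (((β ∙ γ) ∙ δ) ∙ ε)  ≈⟨ ∙-cong {φ = α} ≈-refl (∙-assoc (β ∙ γ) δ ε) ⟩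
    α ∙ ((β ∙ γ) ∙ (δ ∙ ε))  ≈⟨ ≈-sym (∙-assoc α (β ∙ γ) (δ ∙ ε)) ⟩
    (α ∙ (β ∙ γ)) ∙ (δ ∙ ε)  ≈⟨ ∙-cong (≈-sym (∙-assoc α β γ)) (≈-refl {δ ∙ ε}) ⟩
    ((α ∙ β) ∙ γ) ∙ (δ ∙ ε)  ∎
    where open SetoidReasoning PMap-setoid

  dom-∙-⊆ : ∀ (φ ψ : PMap d) → dom (φ ∙ ψ) ⊆ dom φ
  dom-∙-⊆ φ ψ (_ , e) with y , φx≡y , _ ← ∙-just⁻ φ ψ e = y , φx≡y

  ran-∙-⊆ : ∀ (φ ψ : PMap d) → ran (φ ∙ ψ) ⊆ ran ψ
  ran-∙-⊆ φ ψ (_ , e) with y , _ , ψy≡z ← ∙-just⁻ φ ψ e = y , ψy≡z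

  dom-∙ : ∀ (φ ψ : PMap d) → ran φ ⊆ dom ψ → dom (φ ∙ ψ) ≐ dom φ
  dom-∙ φ ψ ran⊆dom = dom-∙-⊆ φ ψ , λ where
    (y , φx≡y) → let z , ψy≡z = ran⊆dom (_ , φx≡y) in z , ∙-just⁺ φ ψ φx≡y ψy≡z

  ran-∙ : ∀ (φ ψ : PMap d) → dom ψ ⊆ ran φ → ran (φ ∙ ψ) ≐ ran ψ
  ran-∙ φ ψ dom⊆ran = ran-∙-⊆ φ ψ , λ where
    (y , ψy≡z) → let x , φx≡y = dom⊆ran (_ , ψy≡z) in x , ∙-just⁺ φ ψ φx≡y ψy≡z

  ∙-isPartialIso : ∀ {φ ψ : PMap d} → IsPartialIso φ → IsPartialIso ψ → IsPartialIso (φ ∙ ψ)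
  ∙-isPartialIso {φ} {ψ} (φ-inj , φ-adj) (ψ-inj , ψ-adj) = injective , adjacency
    where
    injective : ∀ x x′ z → (φ ∙ ψ) x ≡ just z → (φ ∙ ψ) x′ ≡ just z → x ≡ x′
    injective x x′ z e e′
      with y , φx , ψy ← ∙-just⁻ φ ψ e | y′ , φx′ , ψy′ ← ∙-just⁻ φ ψ e′
      with refl ← ψ-inj y y′ z ψy ψy′ = φ-inj x x′ y φx φx′
    adjacency : ∀ x y x″ y″ → (φ ∙ ψ) x ≡ just x″ → (φ ∙ ψ) y ≡ just y″ →
                (Adj x y → Adj x″ y″) × (Adj x″ y″ → Adj x y)
    adjacency x y x″ y″ e e′
      with u , φx , ψu ← ∙-just⁻ φ ψ e | v , φy , ψv ← ∙-just⁻ φ ψ e′ =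
      let (φ⇒ , φ⇐) = φ-adj x y u v φx φy
          (ψ⇒ , ψ⇐) = ψ-adj u v x″ y″ ψu ψv
      in (λ a → ψ⇒ (φ⇒ a)) , (λ a → φ⇐ (ψ⇐ a))

  PreservesLevel : PMap d → Set
  PreservesLevel φ = ∀ x (y : Addr d) → φ x ≡ just y → level y ≡ level x

  IsLevelIso : PMap d → Set
  IsLevelIso φ = IsPartialIso φ × PreservesLevel φ

  ∙-preservesLevel : ∀ {φ ψ : PMap d} → PreservesLevel φ → PreservesLevel ψ → PreservesLevel (φ ∙ ψ)
  ∙-preservesLevel {φ} {ψ} φ-lv ψ-lv x z e with y , φx , ψy ← ∙-just⁻ φ ψ e =
    trans (ψ-lv y z ψy) (φ-lv x y φx)

  ∙-isLevelIso : ∀ {φ ψ : PMap d} → IsLevelIso φ → IsLevelIso ψ → IsLevelIso (φ ∙ ψ)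
  ∙-isLevelIso (φ-iso , φ-lv) (ψ-iso , ψ-lv) = ∙-isPartialIso φ-iso ψ-iso , ∙-preservesLevel φ-lv ψ-lv

  addresses : ℕ → List (Addr d)
  addresses zero    = [ [] ]
  addresses (suc n) = cartesianProductWith _∷_ (allFin d) (addresses n)

  ∈-addresses : ∀ (x : Addr d) → x ∈ addresses (level x)
  ∈-addresses []      = here refl
  ∈-addresses (i ∷ x) = ∈-cartesianProductWith⁺ _∷_ (∈-allFin i) (∈-addresses x)

  preimage? : ∀ (φ : PMap d) y → Dec (Any (λ x → φ x ≡ just y) (addresses (level y)))
  preimage? φ y = any? (λ x → ≡-decᴹ (≡-decᴸ _≟ᶠ_) (φ x) (just y)) (addresses (level y))

  infix 30 _⁻¹

  _⁻¹ : PMap d → PMap d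
  (φ ⁻¹) y with preimage? φ y
  ... | yes p = just (proj₁ (satisfied p))
  ... | no _  = nothing

  ⁻¹-sound : ∀ (φ : PMap d) {x y} → (φ ⁻¹) y ≡ just x → φ x ≡ just y
  ⁻¹-sound φ {y = y} e with preimage? φ y
  ... | yes p with refl ← e = proj₂ (satisfied p)

  ⁻¹-complete : ∀ {φ : PMap d} → IsLevelIso φ → ∀ {x y} → φ x ≡ just y → (φ ⁻¹) y ≡ just x
  ⁻¹-complete {φ} ((φ-inj , _) , φ-lv) {x} {y} φx≡y with preimage? φ y
  ... | yes p = cong just (φ-inj _ x y (proj₂ (satisfied p)) φx≡y)
  ... | no ∄  = ⊥-elim (∄ (lose x∈addresses φx≡y))
    where
    x∈addresses : x ∈ addresses (level y)
    x∈addresses = subst (λ n → x ∈ addresses n) (sym (φ-lv x y φx≡y)) (∈-addresses x)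

  dom-⁻¹ : ∀ {φ : PMap d} → IsLevelIso φ → dom (φ ⁻¹) ≐ ran φ
  dom-⁻¹ {φ} φ-li = (λ (x , e) → x , ⁻¹-sound φ e) , (λ (x , e) → x , ⁻¹-complete φ-li e)

  ran-⁻¹ : ∀ {φ : PMap d} → IsLevelIso φ → ran (φ ⁻¹) ≐ dom φ
  ran-⁻¹ {φ} φ-li = (λ (y , e) → y , ⁻¹-sound φ e) , (λ (y , e) → y , ⁻¹-complete φ-li e)

  ⁻¹-preservesLevel : ∀ {φ : PMap d} → PreservesLevel φ → PreservesLevel (φ ⁻¹)
  ⁻¹-preservesLevel {φ} φ-lv y x e = sym (φ-lv x y (⁻¹-sound φ e))

  ⁻¹-isLevelIso : ∀ {φ : PMap d} → IsLevelIso φ → IsLevelIso (φ ⁻¹)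
  ⁻¹-isLevelIso {φ} ((φ-inj , φ-adj) , φ-lv) = (injective , adjacency) , ⁻¹-preservesLevel φ-lv
    where
    injective : ∀ y y′ x → (φ ⁻¹) y ≡ just x → (φ ⁻¹) y′ ≡ just x → y ≡ y′
    injective y y′ x e e′ = just-injective (trans (sym (⁻¹-sound φ e)) (⁻¹-sound φ e′))
    adjacency : ∀ y y′ x x′ → (φ ⁻¹) y ≡ just x → (φ ⁻¹) y′ ≡ just x′ →
                (Adj y y′ → Adj x x′) × (Adj x x′ → Adj y y′)
    adjacency y y′ x x′ e e′ =
      let (φ⇒ , φ⇐) = φ-adj x x′ y y′ (⁻¹-sound φ e) (⁻¹-sound φ e′) in φ⇐ , φ⇒

  IsIdOn : VSet d → PMap d → Set
  IsIdOn A ρ = (∀ {x z} → ρ x ≡ just z → z ≡ x) × (∀ {x} → A x → ρ x ≡ just x)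

  idOn-∙ˡ : ∀ {ρ ψ : PMap d} → IsIdOn A ρ → dom ψ ⊆ A → (ρ ∙ ψ) ≈ ψ
  idOn-∙ˡ {ρ = ρ} {ψ} (ρ⊆id , A⊆ρ) dom⊆A = ⊑-antisym
    (λ e → let y , ρx≡y , ψy≡z = ∙-just⁻ ρ ψ e
           in subst (λ x → ψ x ≡ just _) (ρ⊆id ρx≡y) ψy≡z)
    (λ ψx≡z → ∙-just⁺ ρ ψ (A⊆ρ (dom⊆A (_ , ψx≡z))) ψx≡z)

  idOn-∙ʳ : ∀ {ρ ψ : PMap d} → IsIdOn A ρ → ran ψ ⊆ A → (ψ ∙ ρ) ≈ ψ
  idOn-∙ʳ {ρ = ρ} {ψ} (ρ⊆id , A⊆ρ) ran⊆A = ⊑-antisym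
    (λ e → let y , ψx≡y , ρy≡z = ∙-just⁻ ψ ρ e
           in subst (λ z → ψ _ ≡ just z) (sym (ρ⊆id ρy≡z)) ψx≡y)
    (λ ψx≡z → ∙-just⁺ ψ ρ ψx≡z (A⊆ρ (ran⊆A (_ , ψx≡z))))

  ∙⁻¹-isIdOn : ∀ {φ : PMap d} → IsLevelIso φ → IsIdOn (dom φ) (φ ∙ φ ⁻¹)
  ∙⁻¹-isIdOn {φ} φ-li@((φ-inj , _) , _) =
    (λ e → let y , φx≡y , φ⁻¹y≡z = ∙-just⁻ φ (φ ⁻¹) e
           in φ-inj _ _ y (⁻¹-sound φ φ⁻¹y≡z) φx≡y) ,
    (λ (_ , φx≡y) → ∙-just⁺ φ (φ ⁻¹) φx≡y (⁻¹-complete φ-li φx≡y))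

  ⁻¹∙-isIdOn : ∀ {φ : PMap d} → IsLevelIso φ → IsIdOn (ran φ) (φ ⁻¹ ∙ φ)
  ⁻¹∙-isIdOn {φ} φ-li =
    (λ e → let x , φ⁻¹y≡x , φx≡z = ∙-just⁻ (φ ⁻¹) φ e
           in just-injective (trans (sym φx≡z) (⁻¹-sound φ φ⁻¹y≡x))) ,
    (λ (_ , φx≡y) → ∙-just⁺ (φ ⁻¹) φ (⁻¹-complete φ-li φx≡y) φx≡y)

  ParentClosed : VSet d → Set
  ParentClosed A = ∀ (i : Fin d) x → A (i ∷ x) → A x

  module _ {φ : PMap d} (closed : ParentClosed (dom φ)) (φ-iso : IsPartialIso φ)
           (root : φ [] ≡ just []) where

    -- If instead the parent q of y were the image of the parent of i ∷ p,
    -- then y would be the image of the grandparent, contradicting injectivity.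
    image-child : ∀ {i p y q} → φ (i ∷ p) ≡ just y → φ p ≡ just q → ∃[ j ] y ≡ j ∷ q
    image-child {i} {p} {y} {q} φip≡y φp≡q
      with proj₁ (proj₂ φ-iso (i ∷ p) p y q φip≡y φp≡q) (inj₂ (i , refl))
    ... | inj₂ y-child = y-child
    image-child {p = []} φip≡y φp≡q | inj₁ (_ , q≡jy)
      with () ← trans (just-injective (trans (sym root) φp≡q)) q≡jy
    image-child {i} {i′ ∷ p′} {y} φip≡y φp≡q | inj₁ (_ , q≡jy)
      with q′ , φp′≡q′ ← closed i′ p′ (_ , φp≡q)
      with _ , q≡j′q′ ← image-child φp≡q φp′≡q′
      with refl ← ∷-injectiveʳ (trans (sym q≡jy) q≡j′q′)
      = ⊥-elim (m≢1+n+m (level p′) (sym (cong level ip≡p′)))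
      where
      ip≡p′ : i ∷ i′ ∷ p′ ≡ p′
      ip≡p′ = proj₁ φ-iso (i ∷ i′ ∷ p′) p′ y φip≡y φp′≡q′

    rooted⇒preservesLevel : PreservesLevel φ
    rooted⇒preservesLevel [] y φ[]≡y with refl ← just-injective (trans (sym root) φ[]≡y) = refl
    rooted⇒preservesLevel (i ∷ p) y φip≡y
      with q , φp≡q ← closed i p (_ , φip≡y)
      with _ , refl ← image-child φip≡y φp≡q
      = cong suc (rooted⇒preservesLevel p q φp≡q)

    rooted⇒ran-parentClosed : ParentClosed (ran φ)
    rooted⇒ran-parentClosed i q ([] , φ[]≡iq) with () ← trans (sym root) φ[]≡iq
    rooted⇒ran-parentClosed i q (i′ ∷ p , φi′p≡iq)
      with q′ , φp≡q′ ← closed i′ p (_ , φi′p≡iq)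
      with _ , iq≡jq′ ← image-child φi′p≡iq φp≡q′
      with refl ← ∷-injectiveʳ iq≡jq′
      = p , φp≡q′

  rootedIso-dom : ∀ {φ : PMap d} → IsRootedIso A B φ → dom φ ≐ A
  rootedIso-dom (dom⇔A , _) = (λ {x} → proj₁ (dom⇔A x)) , (λ {x} → proj₂ (dom⇔A x))

  rootedIso-ran : ∀ {φ : PMap d} → IsRootedIso A B φ → ran φ ≐ B
  rootedIso-ran (_ , ran⇔B , _) = (λ {y} → proj₁ (ran⇔B y)) , (λ {y} → proj₂ (ran⇔B y))

  isRootedIso : ∀ {φ : PMap d} → dom φ ≐ A → ran φ ≐ B → IsPartialIso φ → φ [] ≡ just [] →
                IsRootedIso A B φ
  isRootedIso (dom⊆A , A⊆dom) (ran⊆B , B⊆ran) φ-iso root =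
    (λ x → dom⊆A , A⊆dom) , (λ y → ran⊆B , B⊆ran) , φ-iso , root

  ∙-isRootedIso : ∀ {φ ψ : PMap d} → IsRootedIso A B φ → IsRootedIso B C ψ →
                  IsRootedIso A C (φ ∙ ψ)
  ∙-isRootedIso {B = B} {φ = φ} {ψ} φ-ri@(_ , _ , φ-iso , φ-root) ψ-ri@(_ , _ , ψ-iso , ψ-root) =
    isRootedIso
      (≐-trans (dom-∙ φ ψ (proj₂ dom≐B ∘ proj₁ ran≐B)) (rootedIso-dom φ-ri))
      (≐-trans (ran-∙ φ ψ (proj₂ ran≐B ∘ proj₁ dom≐B)) (rootedIso-ran ψ-ri))
      (∙-isPartialIso φ-iso ψ-iso)
      (∙-just⁺ φ ψ φ-root ψ-root)
    where
    ran≐B : ran φ ≐ B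
    ran≐B = rootedIso-ran φ-ri
    dom≐B : dom ψ ≐ B
    dom≐B = rootedIso-dom ψ-ri

  ⁻¹-isRootedIso : ∀ {φ : PMap d} → PreservesLevel φ → IsRootedIso A B φ → IsRootedIso B A (φ ⁻¹)
  ⁻¹-isRootedIso φ-lv φ-ri@(_ , _ , φ-iso , φ-root) =
    isRootedIso
      (≐-trans (dom-⁻¹ φ-li) (rootedIso-ran φ-ri))
      (≐-trans (ran-⁻¹ φ-li) (rootedIso-dom φ-ri))
      (proj₁ (⁻¹-isLevelIso φ-li))
      (⁻¹-complete φ-li φ-root)
    where
    φ-li = φ-iso , φ-lv

  rootedIso-dom-parentClosed : ∀ {φ : PMap d} → ParentClosed A → IsRootedIso A B φ →
                               ParentClosed (dom φ)
  rootedIso-dom-parentClosed A-closed φ-ri i x =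
    proj₂ (rootedIso-dom φ-ri) ∘ A-closed i x ∘ proj₁ (rootedIso-dom φ-ri)

  rootedIso-preservesLevel : ∀ {φ : PMap d} → ParentClosed A → IsRootedIso A B φ → PreservesLevel φ
  rootedIso-preservesLevel A-closed φ-ri@(_ , _ , φ-iso , φ-root) =
    rooted⇒preservesLevel (rootedIso-dom-parentClosed A-closed φ-ri) φ-iso φ-root

  rootedIso-isSubtree : ∀ {φ : PMap d} → IsSubtree k A → IsRootedIso A B φ → IsSubtree k B
  rootedIso-isSubtree {k = k} {B = B} {φ = φ} (A-bounded , _ , A-closed) φ-ri@(_ , _ , φ-iso , φ-root) =
    B-bounded , ran⊆B ([] , φ-root) , B-closed
    where
    ran⊆B = proj₁ (rootedIso-ran φ-ri)
    B⊆ran = proj₂ (rootedIso-ran φ-ri)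
    B-bounded : ∀ y → B y → InT k y
    B-bounded y By with x , φx≡y ← B⊆ran By =
      subst (_≤ k) (sym (rootedIso-preservesLevel A-closed φ-ri x y φx≡y))
            (A-bounded x (proj₁ (rootedIso-dom φ-ri) (y , φx≡y)))
    B-closed : ParentClosed B
    B-closed i y = ran⊆B ∘ ran-closed i y ∘ B⊆ran
      where ran-closed = rooted⇒ran-parentClosed (rootedIso-dom-parentClosed A-closed φ-ri) φ-iso φ-root

  RootedIsos : VSet d → VSet d → Setoid _ _
  RootedIsos A B = subSetoid d (IsRootedIso A B)

  subSetoid-↔ : ∀ {P Q : PMap d → Set} → (∀ {φ} → P φ → Q φ) → (∀ {φ} → Q φ → P φ) →
                Inverse (subSetoid d P) (subSetoid d Q)
  subSetoid-↔ P⇒Q Q⇒P = record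
    { to        = λ (φ , p) → φ , P⇒Q p
    ; from      = λ (φ , q) → φ , Q⇒P q
    ; to-cong   = id
    ; from-cong = id
    ; inverse   = id , id
    }

  RootedIsos-cong : ∀ {α β : PMap d} →
                    IsRootedIso A′ A α → PreservesLevel α → IsRootedIso B B′ β → PreservesLevel β →
                    Inverse (RootedIsos A B) (RootedIsos A′ B′)
  RootedIsos-cong {A′ = A′} {A = A} {B = B} {B′ = B′} {α = α} {β = β} α-ri α-lv β-ri β-lv = record
    { to        = to
    ; from      = from
    ; to-cong   = to-cong
    ; from-cong = from-cong
    ; inverse   = (λ {τ} τ′≈ → ≈-trans (to-cong τ′≈) (to∘from τ))
                , (λ {τ} τ′≈ → ≈-trans (from-cong τ′≈) (from∘to τ))
    }
    where
    α-li : IsLevelIso α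
    α-li = proj₁ (proj₂ (proj₂ α-ri)) , α-lv
    β-li : IsLevelIso β
    β-li = proj₁ (proj₂ (proj₂ β-ri)) , β-lv

    to : Σ (PMap d) (IsRootedIso A B) → Σ (PMap d) (IsRootedIso A′ B′)
    to (τ , τ-ri) = (α ∙ τ) ∙ β , ∙-isRootedIso (∙-isRootedIso α-ri τ-ri) β-ri

    from : Σ (PMap d) (IsRootedIso A′ B′) → Σ (PMap d) (IsRootedIso A B)
    from (τ , τ-ri) = (α ⁻¹ ∙ τ) ∙ β ⁻¹ ,
      ∙-isRootedIso (∙-isRootedIso (⁻¹-isRootedIso α-lv α-ri) τ-ri) (⁻¹-isRootedIso β-lv β-ri)

    to-cong : ∀ {τ τ′} → τ ≈ τ′ → ((α ∙ τ) ∙ β) ≈ ((α ∙ τ′) ∙ β)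
    to-cong τ≈τ′ = ∙-cong (∙-cong {φ = α} ≈-refl τ≈τ′) (≈-refl {β})

    from-cong : ∀ {τ τ′} → τ ≈ τ′ → ((α ⁻¹ ∙ τ) ∙ β ⁻¹) ≈ ((α ⁻¹ ∙ τ′) ∙ β ⁻¹)
    from-cong τ≈τ′ = ∙-cong (∙-cong {φ = α ⁻¹} ≈-refl τ≈τ′) (≈-refl {β ⁻¹})

    to∘from : ∀ τ → proj₁ (to (from τ)) ≈ proj₁ τ
    to∘from (τ , τ-ri) = begin
      (α ∙ ((α ⁻¹ ∙ τ) ∙ β ⁻¹)) ∙ β  ≈⟨ ∙-reassoc α (α ⁻¹) τ (β ⁻¹) β ⟩
      ((α ∙ α ⁻¹) ∙ τ) ∙ (β ⁻¹ ∙ β)  ≈⟨ idOn-∙ʳ (⁻¹∙-isIdOn β-li) (ran⊆ran-β ∘ ran-∙-⊆ (α ∙ α ⁻¹) τ) ⟩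
      (α ∙ α ⁻¹) ∙ τ                  ≈⟨ idOn-∙ˡ (∙⁻¹-isIdOn α-li) dom⊆dom-α ⟩
      τ                               ∎
      where
      open SetoidReasoning PMap-setoid
      dom⊆dom-α : dom τ ⊆ dom α
      dom⊆dom-α = proj₂ (rootedIso-dom α-ri) ∘ proj₁ (rootedIso-dom τ-ri)
      ran⊆ran-β : ran τ ⊆ ran β
      ran⊆ran-β = proj₂ (rootedIso-ran β-ri) ∘ proj₁ (rootedIso-ran τ-ri)

    from∘to : ∀ τ → proj₁ (from (to τ)) ≈ proj₁ τ
    from∘to (τ , τ-ri) = begin
      (α ⁻¹ ∙ ((α ∙ τ) ∙ β)) ∙ β ⁻¹  ≈⟨ ∙-reassoc (α ⁻¹) α τ β (β ⁻¹) ⟩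
      ((α ⁻¹ ∙ α) ∙ τ) ∙ (β ∙ β ⁻¹)  ≈⟨ idOn-∙ʳ (∙⁻¹-isIdOn β-li) (ran⊆dom-β ∘ ran-∙-⊆ (α ⁻¹ ∙ α) τ) ⟩
      (α ⁻¹ ∙ α) ∙ τ                  ≈⟨ idOn-∙ˡ (⁻¹∙-isIdOn α-li) dom⊆ran-α ⟩
      τ                               ∎
      where
      open SetoidReasoning PMap-setoid
      dom⊆ran-α : dom τ ⊆ ran α
      dom⊆ran-α = proj₂ (rootedIso-ran α-ri) ∘ proj₁ (rootedIso-dom τ-ri)
      ran⊆dom-β : ran τ ⊆ dom β
      ran⊆dom-β = proj₂ (rootedIso-dom β-ri) ∘ proj₁ (rootedIso-ran τ-ri)

  subtree-parentClosed : IsSubtree k A → ParentClosed A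
  subtree-parentClosed = proj₂ ∘ proj₂

  isSubtree-resp : A ≐ B → IsSubtree k A → IsSubtree k B
  isSubtree-resp (A⊆B , B⊆A) (A-bounded , A-root , A-closed) =
    (λ x → A-bounded x ∘ B⊆A) , A⊆B A-root , (λ i x → A⊆B ∘ A-closed i x ∘ B⊆A)

  isPAut : ∀ {φ : PMap d} → IsSubtree k A → dom φ ≐ A → IsLevelIso φ → IsPAut k φ
  isPAut A-subtree dom≐A φ-li = isSubtree-resp (≐-sym dom≐A) A-subtree , φ-li

  pAut-root : ∀ {σ : PMap d} → IsPAut k σ → σ [] ≡ just []
  pAut-root ((_ , ([] , σ[]≡[]) , _) , _) = σ[]≡[]
  pAut-root ((_ , (_ ∷ _ , σ[]≡y) , _) , _ , σ-lv) with () ← σ-lv [] _ σ[]≡y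

  pAut-isRootedIso : ∀ {σ : PMap d} → IsPAut k σ → IsRootedIso (dom σ) (ran σ) σ
  pAut-isRootedIso σ-pAut@(_ , σ-iso , _) = isRootedIso ≐-refl ≐-refl σ-iso (pAut-root σ-pAut)

  pAut-ran-isSubtree : ∀ {σ : PMap d} → IsPAut k σ → IsSubtree k (ran σ)
  pAut-ran-isSubtree σ-pAut = rootedIso-isSubtree (proj₁ σ-pAut) (pAut-isRootedIso σ-pAut)

  rightIdeal⇒dom⊆ : ∀ {σ τ : PMap d} → InRightIdeal k τ σ → dom τ ⊆ dom σ
  rightIdeal⇒dom⊆ (inj₁ τ≈σ) (z , τx≡z) = z , trans (sym (τ≈σ _)) τx≡z
  rightIdeal⇒dom⊆ {σ = σ} (inj₂ (a , _ , τ≈σa)) (z , τx≡z) =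
    dom-∙-⊆ σ a (z , trans (sym (τ≈σa _)) τx≡z)

  leftIdeal⇒ran⊆ : ∀ {σ τ : PMap d} → InLeftIdeal k τ σ → ran τ ⊆ ran σ
  leftIdeal⇒ran⊆ (inj₁ τ≈σ) (x , τx≡y) = x , trans (sym (τ≈σ x)) τx≡y
  leftIdeal⇒ran⊆ {σ = σ} (inj₂ (a , _ , τ≈aσ)) (x , τx≡y) =
    ran-∙-⊆ a σ (x , trans (sym (τ≈aσ x)) τx≡y)

  dom≐⇒rightIdeal : ∀ {σ τ : PMap d} → IsPAut k σ → IsPAut k τ → dom τ ≐ dom σ →
                    InRightIdeal k τ σ
  dom≐⇒rightIdeal {k = k} {σ = σ} {τ} σ-pAut τ-pAut (τ⊆σ , σ⊆τ) = inj₂ (σ ⁻¹ ∙ τ , a-pAut , τ≈σa)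
    where
    σ-li = proj₂ σ-pAut
    a-pAut : IsPAut k (σ ⁻¹ ∙ τ)
    a-pAut = isPAut (pAut-ran-isSubtree σ-pAut)
      (≐-trans (dom-∙ (σ ⁻¹) τ (σ⊆τ ∘ proj₁ (ran-⁻¹ σ-li))) (dom-⁻¹ σ-li))
      (∙-isLevelIso (⁻¹-isLevelIso σ-li) (proj₂ τ-pAut))
    τ≈σa : τ ≈ (σ ∙ (σ ⁻¹ ∙ τ))
    τ≈σa = ≈-sym (begin
      σ ∙ (σ ⁻¹ ∙ τ)  ≈⟨ ≈-sym (∙-assoc σ (σ ⁻¹) τ) ⟩
      (σ ∙ σ ⁻¹) ∙ τ  ≈⟨ idOn-∙ˡ (∙⁻¹-isIdOn σ-li) τ⊆σ ⟩
      τ               ∎)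
      where open SetoidReasoning PMap-setoid

  ran⊆⇒leftIdeal : ∀ {σ τ : PMap d} → IsPAut k σ → IsPAut k τ → ran τ ⊆ ran σ →
                   InLeftIdeal k τ σ
  ran⊆⇒leftIdeal {k = k} {σ = σ} {τ} σ-pAut τ-pAut τ⊆σ = inj₂ (τ ∙ σ ⁻¹ , a-pAut , τ≈aσ)
    where
    σ-li = proj₂ σ-pAut
    a-pAut : IsPAut k (τ ∙ σ ⁻¹)
    a-pAut = isPAut (proj₁ τ-pAut)
      (dom-∙ τ (σ ⁻¹) (proj₂ (dom-⁻¹ σ-li) ∘ τ⊆σ))
      (∙-isLevelIso (proj₂ τ-pAut) (⁻¹-isLevelIso σ-li))
    τ≈aσ : τ ≈ ((τ ∙ σ ⁻¹) ∙ σ)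
    τ≈aσ = ≈-sym (begin
      (τ ∙ σ ⁻¹) ∙ σ  ≈⟨ ∙-assoc τ (σ ⁻¹) σ ⟩
      τ ∙ (σ ⁻¹ ∙ σ)  ≈⟨ idOn-∙ʳ (⁻¹∙-isIdOn σ-li) τ⊆σ ⟩
      τ               ∎)
      where open SetoidReasoning PMap-setoid

  H⇒isRootedIso : ∀ {σ τ : PMap d} → IsPAut k τ × GreenH k τ σ → IsRootedIso (dom σ) (ran σ) τ
  H⇒isRootedIso (τ-pAut , (τRσ , σRτ) , (τLσ , σLτ)) =
    isRootedIso (rightIdeal⇒dom⊆ τRσ , rightIdeal⇒dom⊆ σRτ) (leftIdeal⇒ran⊆ τLσ , leftIdeal⇒ran⊆ σLτ)
                (proj₁ (proj₂ τ-pAut)) (pAut-root τ-pAut)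

  isRootedIso⇒H : ∀ {σ τ : PMap d} → IsPAut k σ → IsRootedIso (dom σ) (ran σ) τ →
                  IsPAut k τ × GreenH k τ σ
  isRootedIso⇒H σ-pAut τ-ri@(_ , _ , τ-iso , _) =
    τ-pAut ,
    (dom≐⇒rightIdeal σ-pAut τ-pAut dom≐ , dom≐⇒rightIdeal τ-pAut σ-pAut (≐-sym dom≐)) ,
    (ran⊆⇒leftIdeal σ-pAut τ-pAut (proj₁ ran≐) , ran⊆⇒leftIdeal τ-pAut σ-pAut (proj₂ ran≐))
    where
    dom≐ = rootedIso-dom τ-ri
    ran≐ = rootedIso-ran τ-ri
    τ-pAut = isPAut (proj₁ σ-pAut) dom≐
      (τ-iso , rootedIso-preservesLevel (subtree-parentClosed (proj₁ σ-pAut)) τ-ri)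

  HClass↔RootedIsos : ∀ {σ : PMap d} → IsPAut k σ → Inverse (HClass k σ) (RootedIsos (dom σ) (ran σ))
  HClass↔RootedIsos σ-pAut = subSetoid-↔ H⇒isRootedIso (isRootedIso⇒H σ-pAut)

mainTheorem12 : (d k : ℕ) → 1 ≤ d → 1 ≤ k →
    (Γ : VSet d) → IsSubtree k Γ →
    (σ : PMap d) → IsPAut k σ → dom σ ≅ Γ →
    Inverse (HClass k σ) (AutSetoid Γ)
mainTheorem12 d k _ _ Γ _ σ σ-pAut (f , f-ri) =
  inverse (HClass↔RootedIsos σ-pAut) (RootedIsos-cong α-ri α-lv β-ri β-lv)
  where
  σ-lv : PreservesLevel σ
  σ-lv = proj₂ (proj₂ σ-pAut)
  f-lv : PreservesLevel f
  f-lv = rootedIso-preservesLevel (subtree-parentClosed (proj₁ σ-pAut)) f-ri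
  α-ri : IsRootedIso Γ (dom σ) (f ⁻¹)
  α-ri = ⁻¹-isRootedIso f-lv f-ri
  α-lv : PreservesLevel (f ⁻¹)
  α-lv = ⁻¹-preservesLevel f-lv
  β-ri : IsRootedIso (ran σ) Γ (σ ⁻¹ ∙ f)
  β-ri = ∙-isRootedIso (⁻¹-isRootedIso σ-lv (pAut-isRootedIso σ-pAut)) f-ri
  β-lv : PreservesLevel (σ ⁻¹ ∙ f)
  β-lv = ∙-preservesLevel (⁻¹-preservesLevel σ-lv) f-lv
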